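{- For every $n$ (sufficiently large so that the construction makes sense), there exists a connected bipartite graph $G$ of order $n$ with $\mathrm{Mo}(G)\ge \frac{n^3}{6\sqrt{3}}-6n$.
   Context: For a graph $G$ and an edge $\{u,v\}\in E(G)$, let $n_G(u,v)$ denote the number of vertices of $G$ that are strictly closer to $u$ than to $v$. The Mostar index of $G$ is $\mathrm{Mo}(G)=\sum_{\{u,v\}\in E(G)}|n_G(u,v)-n_G(v,u)|$. -}

module Defs where

open import Data.Nat using (ℕ; zero; suc; _+_; _*_; _^_; _≤_; _<_; ∣_-_∣)
open import Data.Nat.Base using (_<ᵇ_)
open import Data.Bool using (Bool; true; false; _∨_; _∧_; if_then_else_)
open import Data.Fin using (Fin; toℕ; _≟_)
open import Data.List using (List; map; allFin)
open import Data.Nat.ListAction using (sum)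
open import Data.Bool.ListAction using (any)
open import Data.Product using (Σ; ∃; _×_; _,_)
open import Relation.Nullary using (¬_)
open import Relation.Nullary.Decidable using (⌊_⌋)
open import Relation.Binary.PropositionalEquality using (_≡_)

record Graph (n : ℕ) : Set where
  field
    adj    : Fin n → Fin n → Bool
    sym    : ∀ u v → adj u v ≡ adj v u
    irrefl : ∀ u → adj u u ≡ false
open Graph public

module _ {n : ℕ} (G : Graph n) where

  data Walk : Fin n → Fin n → ℕ → Set where
    here : ∀ {u} → Walk u u 0
    step : ∀ {u v w k} → adj G u v ≡ true → Walk v w k → Walk u w (suc k)

  Connected : Set
  Connected = ∀ u v → ∃ λ k → Walk u v k

  Bipartite : Set
  Bipartite = Σ (Fin n → Bool) λ c → ∀ u v → adj G u v ≡ true → ¬ (c u ≡ c v)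

  within : ℕ → Fin n → Fin n → Bool
  within zero    u v = ⌊ u ≟ v ⌋
  within (suc k) u v = within k u v ∨ any (λ w → within k u w ∧ adj G w v) (allFin n)

  -- least k < bound with f k = true, or bound if there is none
  firstTrue : ℕ → (ℕ → Bool) → ℕ
  firstTrue zero    f = zero
  firstTrue (suc b) f = if f zero then zero else suc (firstTrue b (λ k → f (suc k)))

  -- shortest-path distance (in a connected graph on n vertices it is < n,
  -- so the search bound n is never reached)
  dist : Fin n → Fin n → ℕ
  dist u v = firstTrue n (λ k → within k u v)

  nG : Fin n → Fin n → ℕ
  nG u v = sum (map (λ w → if dist w u <ᵇ dist w v then 1 else 0) (allFin n))

  Mostar : ℕ
  Mostar = sum (map (λ u → sum (map (λ v →
             if adj G u v ∧ (toℕ u <ᵇ toℕ v) then ∣ nG u v - nG v u ∣ else 0)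
             (allFin n))) (allFin n))

{-# OPTIONS --safe #-}
module Submission where

-- In K_{a,b} any two vertices are at distance at most 2, so for an edge xy with x on the a-side
-- n(x,y) = b and n(y,x) = a, and Mo(K_{a,b}) = ab(b − a). With n = a + b and d = b − a this is
-- (n² − d²)d/4, maximal at d = n/√3 with value n³/(6√3). Taking a least with 3(n − 2a)² ≤ n² puts d
-- within 2 of n/√3, and the resulting loss is O(n), which the term 6n absorbs.

open import Defs
open import Data.Nat
  using (ℕ; zero; suc; _+_; _*_; _^_; _∸_; _≤_; _<_; _<ᵇ_; _≤?_; z≤n; s≤s; z<s; s<s; ∣_-_∣; _/_; _%_)
open import Data.Product using (Σ; ∃; _×_; _,_)
open import Data.Nat.Properties
  using ( ≤-refl; ≤-trans; <-trans; <-≤-trans; ≤-<-trans; ≤-reflexive; <⇒≤; <⇒≱; ≮⇒≥; ≰⇒>; m≤m+n; m≤n+m; n<1+n; m<n⇒m<1+n; ≤-pred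
        ; +-comm; +-assoc; +-identityʳ; +-cancelʳ-≡; +-cancelʳ-≤; +-cancelˡ-<; +-monoʳ-≤; +-mono-≤; m+[n∸m]≡n; m+n∸m≡n; m+n∸n≡m; m<m+n
        ; *-zeroʳ; *-identityʳ; *-monoˡ-≤; *-monoʳ-≤; *-mono-≤; *-cancelˡ-≤; *-cancelˡ-<
        ; ∣-∣-comm; ∣m-m+n∣≡n; <ᵇ⇒<; <⇒<ᵇ; +-0-commutativeMonoid; module ≤-Reasoning )
open import Data.Nat.DivMod using (m≡m%n+[m/n]*n; m%n<n; m/n*n≤m)
open import Data.Nat.Tactic.RingSolver using (solve-∀)
open import Data.Nat.ListAction using (sum)
open import Data.Bool using (Bool; true; false; not; _∧_; _∨_; _xor_; if_then_else_)
open import Data.Bool.Properties using (T-≡; xor-same; xor-comm; ∨-zeroʳ; ¬-not; if-float)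
open import Data.Bool.ListAction using (any)
open import Data.Fin using (Fin; zero; suc; toℕ; fromℕ<; _≟_)
open import Data.Fin.Properties using (toℕ<n; toℕ-fromℕ<)
open import Data.List using (map; allFin; tabulate)
open import Data.List.Properties using (map-tabulate)
open import Data.List.Membership.Propositional using (lose)
open import Data.List.Membership.Propositional.Properties using (∈-allFin)
open import Data.List.Relation.Unary.Any using (satisfied)
open import Data.List.Relation.Unary.Any.Properties using (any⁺; any⁻)
open import Algebra.Properties.CommutativeMonoid.Sum +-0-commutativeMonoid
  using (sum-cong-≗; ∑-distrib-+; sum-replicate-zero) renaming (sum to ∑)
open import Function using (_∘_; id; Equivalence)
open import Relation.Nullary using (¬_; yes; no; does; contradiction)
open import Relation.Nullary.Decidable using (dec-true; dec-false; isYes≗does)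
open import Relation.Unary using (Decidable)
open import Relation.Binary.PropositionalEquality as ≡
  using (_≡_; _≢_; refl; trans; cong; cong₂; subst; subst₂; module ≡-Reasoning)

open Equivalence using (to; from)

𝟙 : Bool → ℕ
𝟙 b = if b then 1 else 0

<⇒<ᵇ≡true : ∀ {m n} → m < n → (m <ᵇ n) ≡ true
<⇒<ᵇ≡true m<n = to T-≡ (<⇒<ᵇ m<n)

<ᵇ≡true⇒< : ∀ {m n} → (m <ᵇ n) ≡ true → m < n
<ᵇ≡true⇒< {m} {n} m<ᵇn = <ᵇ⇒< m n (from T-≡ m<ᵇn)

≥⇒<ᵇ≡false : ∀ {m n} → n ≤ m → (m <ᵇ n) ≡ false
≥⇒<ᵇ≡false n≤m = ¬-not λ m<ᵇn → <⇒≱ (<ᵇ≡true⇒< m<ᵇn) n≤m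

<ᵇ≡false⇒≥ : ∀ {m n} → (m <ᵇ n) ≡ false → n ≤ m
<ᵇ≡false⇒≥ m<ᵇn≡false = ≮⇒≥ λ m<n → contradiction (trans (≡.sym (<⇒<ᵇ≡true m<n)) m<ᵇn≡false) λ ()

xor≡false⇒≡ : ∀ {x y} → x xor y ≡ false → x ≡ y
xor≡false⇒≡ {true}  {true}  _ = refl
xor≡false⇒≡ {false} {false} _ = refl

xor≡true⇒≢ : ∀ {x y} → x xor y ≡ true → x ≢ y
xor≡true⇒≢ {x} x⊕y refl = contradiction (trans (≡.sym x⊕y) (xor-same x)) λ ()

any-allFin-true : ∀ {n} (p : Fin n → Bool) w → p w ≡ true → any p (allFin n) ≡ true
any-allFin-true p w pw = to T-≡ (any⁺ p (lose (∈-allFin w) (from T-≡ pw)))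

any-allFin-false : ∀ {n} (p : Fin n → Bool) → (∀ w → p w ≡ false) → any p (allFin n) ≡ false
any-allFin-false {n} p none = ¬-not λ anyp →
  let w , pw = satisfied (any⁻ p (allFin n) (from T-≡ anyp))
  in contradiction (trans (≡.sym (to T-≡ pw)) (none w)) λ ()

sum-tabulate : ∀ {n} (f : Fin n → ℕ) → sum (tabulate f) ≡ ∑ f
sum-tabulate {zero}  f = refl
sum-tabulate {suc n} f = cong (f zero +_) (sum-tabulate (f ∘ suc))

sum-allFin : ∀ {n} (f : Fin n → ℕ) → sum (map f (allFin n)) ≡ ∑ f
sum-allFin f = trans (cong sum (map-tabulate id f)) (sum-tabulate f)

-- Stated with does: ⌊_⌋ (that is, isYes) does not compute under suc.
∑-𝟙-≟ : ∀ {n} (u : Fin n) → ∑ (λ w → 𝟙 (does (w ≟ u))) ≡ 1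
∑-𝟙-≟ {suc n} zero    = cong suc (sum-replicate-zero n)
∑-𝟙-≟ {suc n} (suc u) = ∑-𝟙-≟ u

∑-threshold : ∀ {n} a x y → a ≤ n → ∑ {n} (λ w → if toℕ w <ᵇ a then x else y) ≡ a * x + (n ∸ a) * y
∑-threshold {zero}  zero    x y _         = refl
∑-threshold {suc n} zero    x y _         = cong (y +_) (∑-threshold {n} zero x y z≤n)
∑-threshold {suc n} (suc a) x y (s≤s a≤n) = trans (cong (x +_) (∑-threshold a x y a≤n)) (≡.sym (+-assoc x (a * x) _))

-- Distances in graphs of diameter at most two

distinct⇒1<n : ∀ {n} {u v : Fin n} → u ≢ v → 1 < n
distinct⇒1<n {suc (suc _)}     _   = s<s z<s
distinct⇒1<n {1} {zero} {zero} u≢v = contradiction refl u≢v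

distinct₃⇒2<n : ∀ {n} {u v w : Fin n} → u ≢ v → v ≢ w → u ≢ w → 2 < n
distinct₃⇒2<n {suc (suc (suc _))}                      _   _   _   = s<s (s<s z<s)
distinct₃⇒2<n {u = zero}     {zero}                    u≢v _   _   = contradiction refl u≢v
distinct₃⇒2<n {u = suc zero} {suc zero}                u≢v _   _   = contradiction refl u≢v
distinct₃⇒2<n {2} {zero}     {suc zero} {zero}         _   _   u≢w = contradiction refl u≢w
distinct₃⇒2<n {2} {zero}     {suc zero} {suc zero}     _   v≢w _   = contradiction refl v≢w
distinct₃⇒2<n {2} {suc zero} {zero}     {zero}         _   v≢w _   = contradiction refl v≢w
distinct₃⇒2<n {2} {suc zero} {zero}     {suc zero}     _   _   u≢w = contradiction refl u≢w

module _ {n : ℕ} (G : Graph n) where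

  adj⇒≢ : ∀ {u v} → adj G u v ≡ true → u ≢ v
  adj⇒≢ {u} uv refl = contradiction (trans (≡.sym uv) (irrefl G u)) λ ()

  within-0-self : ∀ u → within G 0 u u ≡ true
  within-0-self u = trans (isYes≗does (u ≟ u)) (dec-true (u ≟ u) refl)

  within-0-≢ : ∀ {u v} → u ≢ v → within G 0 u v ≡ false
  within-0-≢ {u} {v} u≢v = trans (isYes≗does (u ≟ v)) (dec-false (u ≟ v) u≢v)

  within-1-adj : ∀ {u v} → adj G u v ≡ true → within G 1 u v ≡ true
  within-1-adj {u} {v} uv =
    trans (cong (within G 0 u v ∨_) (any-allFin-true _ u (cong₂ _∧_ (within-0-self u) uv))) (∨-zeroʳ _)

  within-1-nonadj : ∀ {u v} → u ≢ v → adj G u v ≡ false → within G 1 u v ≡ false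
  within-1-nonadj {u} {v} u≢v uv = cong₂ _∨_ (within-0-≢ u≢v) (any-allFin-false _ noStep)
    where
    noStep : ∀ w → within G 0 u w ∧ adj G w v ≡ false
    noStep w with u ≟ w
    ... | yes refl = uv
    ... | no  _    = refl

  within-2-path : ∀ {u v z} → adj G u z ≡ true → adj G z v ≡ true → within G 2 u v ≡ true
  within-2-path {u} {v} {z} uz zv =
    trans (cong (within G 1 u v ∨_) (any-allFin-true _ z (cong₂ _∧_ (within-1-adj uz) zv))) (∨-zeroʳ _)

  firstTrue-≡ : ∀ {b k} (f : ℕ → Bool) → k < b → f k ≡ true → (∀ {j} → j < k → f j ≡ false) →
                firstTrue G b f ≡ k
  firstTrue-≡ {suc b} {zero}  f _         f0 _      rewrite f0 = refl
  firstTrue-≡ {suc b} {suc k} f (s<s k<b) fk before rewrite before z<s =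
    cong suc (firstTrue-≡ (f ∘ suc) k<b fk (before ∘ s<s))

  dist-self : ∀ u → dist G u u ≡ 0
  dist-self u = firstTrue-≡ _ (≤-<-trans z≤n (toℕ<n u)) (within-0-self u) λ ()

  dist-adj : ∀ {u v} → adj G u v ≡ true → dist G u v ≡ 1
  dist-adj uv = firstTrue-≡ _ (distinct⇒1<n (adj⇒≢ uv)) (within-1-adj uv) λ { z<s → within-0-≢ (adj⇒≢ uv) }

  dist-two : ∀ {u v z} → u ≢ v → adj G u v ≡ false → adj G u z ≡ true → adj G z v ≡ true → dist G u v ≡ 2
  dist-two u≢v uv uz zv = firstTrue-≡ _ (distinct₃⇒2<n (adj⇒≢ uz) (adj⇒≢ zv) u≢v) (within-2-path uz zv)
    λ { z<s → within-0-≢ u≢v ; (s<s z<s) → within-1-nonadj u≢v uv }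

  Diameter≤2 : Set
  Diameter≤2 = ∀ u v → u ≢ v → adj G u v ≡ false → ∃ λ z → adj G u z ≡ true × adj G z v ≡ true

  dist-diameter≤2 : Diameter≤2 → ∀ u v →
                    dist G u v ≡ (if does (u ≟ v) then 0 else if adj G u v then 1 else 2)
  dist-diameter≤2 diam u v with u ≟ v | adj G u v in uv
  ... | yes refl | _     = dist-self u
  ... | no  _    | true  = dist-adj uv
  ... | no  u≢v  | false with diam u v u≢v uv
  ...   | z , uz , zv = dist-two u≢v uv uz zv

  diameter≤2⇒connected : Diameter≤2 → Connected G
  diameter≤2⇒connected diam u v with u ≟ v | adj G u v in uv
  ... | yes refl | _     = 0 , here
  ... | no  _    | true  = 1 , step uv here
  ... | no  u≢v  | false with diam u v u≢v uv
  ...   | z , uz , zv = 2 , step uz (step zv here)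

-- The complete bipartite graph K_{a,n−a}

module CompleteBipartite {n : ℕ} (a : ℕ) (0<a : 0 < a) (a<n : a < n) where

  inA : Fin n → Bool
  inA w = toℕ w <ᵇ a

  K : Graph n
  K = record
    { adj    = λ u v → inA u xor inA v
    ; sym    = λ u v → xor-comm (inA u) (inA v)
    ; irrefl = λ u → xor-same (inA u)
    }

  b : ℕ
  b = n ∸ a

  inA⇒< : ∀ {w} → inA w ≡ true → toℕ w < a
  inA⇒< = <ᵇ≡true⇒<

  ¬inA⇒≥ : ∀ {w} → inA w ≡ false → a ≤ toℕ w
  ¬inA⇒≥ = <ᵇ≡false⇒≥

  inA-fromℕ< : ∀ {m} (m<n : m < n) → inA (fromℕ< m<n) ≡ (m <ᵇ a)
  inA-fromℕ< m<n = cong (_<ᵇ a) (toℕ-fromℕ< m<n)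

  crossNeighbour : ∀ u → ∃ λ z → adj K u z ≡ true
  crossNeighbour u with inA u
  ... | true  = fromℕ< a<n , cong not (trans (inA-fromℕ< a<n) (≥⇒<ᵇ≡false {a} ≤-refl))
  ... | false = fromℕ< (<-trans 0<a a<n) , trans (inA-fromℕ< (<-trans 0<a a<n)) (<⇒<ᵇ≡true 0<a)

  diameter≤2 : Diameter≤2 K
  diameter≤2 u v _ uv with crossNeighbour u
  ... | z , uz = z , uz , trans (cong (inA z xor_) (≡.sym (xor≡false⇒≡ {inA u} uv)))
                                (trans (xor-comm (inA z) (inA u)) uz)

  connected : Connected K
  connected = diameter≤2⇒connected K diameter≤2

  bipartite : Bipartite K
  bipartite = inA , λ u v → xor≡true⇒≢

  dist-K : ∀ u v → dist K u v ≡ (if does (u ≟ v) then 0 else if inA u xor inA v then 1 else 2)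
  dist-K = dist-diameter≤2 K diameter≤2

  closer-offEdge : ∀ p q r → q xor r ≡ true →
    𝟙 ((if p xor q then 1 else 2) <ᵇ (if p xor r then 1 else 2)) ≡ 𝟙 (not (p xor r))
  closer-offEdge true  true  false _ = refl
  closer-offEdge true  false true  _ = refl
  closer-offEdge false true  false _ = refl
  closer-offEdge false false true  _ = refl

  -- w is strictly closer to x than to y iff w = x, or w ≠ y lies on y's side;
  -- adding [w = y] to both sides turns this into a pointwise identity.
  closer-count : ∀ {x y} → adj K x y ≡ true → ∀ w →
    𝟙 (dist K w x <ᵇ dist K w y) + 𝟙 (does (w ≟ y)) ≡ 𝟙 (does (w ≟ x)) + 𝟙 (not (inA w xor inA y))
  closer-count {x} {y} xy w rewrite dist-K w x | dist-K w y with w ≟ x | w ≟ y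
  ... | yes refl | yes refl = contradiction refl (adj⇒≢ K xy)
  ... | yes refl | no  _    rewrite xy = refl
  ... | no  _    | yes refl rewrite xor-same (inA w) = refl
  ... | no  _    | no  _    = trans (+-identityʳ _) (closer-offEdge (inA w) (inA x) (inA y) xy)

  ∑-sides : ∀ x y → ∑ (λ w → if inA w then x else y) ≡ a * x + b * y
  ∑-sides x y = ∑-threshold a x y (<⇒≤ a<n)

  𝟙-sameSide : ∀ p q → 𝟙 (not (p xor q)) ≡ (if p then 𝟙 q else 𝟙 (not q))
  𝟙-sameSide true  true  = refl
  𝟙-sameSide true  false = refl
  𝟙-sameSide false true  = refl
  𝟙-sameSide false false = refl

  sideSize : ∀ y → ∑ (λ w → 𝟙 (not (inA w xor inA y))) ≡ (if inA y then a else b)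
  sideSize y = trans (sum-cong-≗ λ w → 𝟙-sameSide (inA w) (inA y)) (trans (∑-sides _ _) (count (inA y)))
    where
    count : ∀ q → a * 𝟙 q + b * 𝟙 (not q) ≡ (if q then a else b)
    count true  = trans (cong₂ _+_ (*-identityʳ a) (*-zeroʳ b)) (+-identityʳ a)
    count false = cong₂ _+_ (*-zeroʳ a) (*-identityʳ b)

  nG-edge : ∀ {x y} → adj K x y ≡ true → nG K x y ≡ (if inA y then a else b)
  nG-edge {x} {y} xy = +-cancelʳ-≡ 1 _ _ (begin
    nG K x y + 1                  ≡⟨ cong₂ _+_ (sum-allFin closer) (≡.sym (∑-𝟙-≟ y)) ⟩
    ∑ closer + ∑ (is y)           ≡⟨ ∑-distrib-+ closer (is y) ⟨
    ∑ (λ w → closer w + is y w)   ≡⟨ sum-cong-≗ (closer-count xy) ⟩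
    ∑ (λ w → is x w + sameSide w) ≡⟨ ∑-distrib-+ (is x) sameSide ⟩
    ∑ (is x) + ∑ sameSide         ≡⟨ cong₂ _+_ (∑-𝟙-≟ x) (sideSize y) ⟩
    1 + (if inA y then a else b)  ≡⟨ +-comm 1 _ ⟩
    (if inA y then a else b) + 1  ∎)
    where
    open ≡-Reasoning
    closer sameSide : Fin n → ℕ
    closer w = 𝟙 (dist K w x <ᵇ dist K w y)
    sameSide w = 𝟙 (not (inA w xor inA y))
    is : Fin n → Fin n → ℕ
    is u w = 𝟙 (does (w ≟ u))

  edgeWeight : ∀ u v → (if adj K u v ∧ (toℕ u <ᵇ toℕ v) then ∣ nG K u v - nG K v u ∣ else 0)
                     ≡ (if inA v then 0 else if inA u then ∣ b - a ∣ else 0)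
  edgeWeight u v with inA u in eu | inA v in ev
  ... | true  | true  = refl
  ... | false | false = refl
  ... | false | true  rewrite ≥⇒<ᵇ≡false {toℕ u} {toℕ v} (<⇒≤ (<-≤-trans (inA⇒< ev) (¬inA⇒≥ eu))) = refl
  ... | true  | false rewrite <⇒<ᵇ≡true {toℕ u} {toℕ v} (<-≤-trans (inA⇒< eu) (¬inA⇒≥ ev)) =
    cong₂ ∣_-_∣ (trans (nG-edge (cong₂ _xor_ eu ev)) (cong (λ q → if q then a else b) ev))
                (trans (nG-edge (cong₂ _xor_ ev eu)) (cong (λ q → if q then a else b) eu))

  mostar-K : Mostar K ≡ a * (b * ∣ b - a ∣)
  mostar-K = begin
    Mostar K
      ≡⟨ sum-allFin (λ u → sum (map (edge u) (allFin n))) ⟩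
    ∑ (λ u → sum (map (edge u) (allFin n)))
      ≡⟨ sum-cong-≗ (λ u → trans (sum-allFin (edge u)) (sum-cong-≗ (edgeWeight u))) ⟩
    ∑ (λ u → ∑ (λ v → if inA v then 0 else if inA u then D else 0))
      ≡⟨ sum-cong-≗ (λ u → ∑-sides 0 (if inA u then D else 0)) ⟩
    ∑ (λ u → a * 0 + b * (if inA u then D else 0))
      ≡⟨ sum-cong-≗ (λ u → if-float (λ z → a * 0 + b * z) (inA u)) ⟩
    ∑ (λ u → if inA u then a * 0 + b * D else a * 0 + b * 0)
      ≡⟨ ∑-sides _ _ ⟩
    a * (a * 0 + b * D) + b * (a * 0 + b * 0)
      ≡⟨ dropZeros a b D ⟩
    a * (b * D)
      ∎
    where
    open ≡-Reasoning
    D : ℕ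
    D = ∣ b - a ∣
    dropZeros : ∀ a b d → a * (a * 0 + b * d) + b * (a * 0 + b * 0) ≡ a * (b * d)
    dropZeros = solve-∀
    edge : Fin n → Fin n → ℕ
    edge u v = if adj K u v ∧ (toℕ u <ᵇ toℕ v) then ∣ nG K u v - nG K v u ∣ else 0

  mostar-K-split : ∀ {d} → n ≡ a + a + d → Mostar K ≡ a * ((a + d) * d)
  mostar-K-split {d} n≡ = begin
    Mostar K                        ≡⟨ mostar-K ⟩
    a * (b * ∣ b - a ∣)             ≡⟨ cong (λ x → a * (x * ∣ x - a ∣)) b≡a+d ⟩
    a * ((a + d) * ∣ a + d - a ∣)   ≡⟨ cong (λ x → a * ((a + d) * x)) (trans (∣-∣-comm (a + d) a) (∣m-m+n∣≡n a d)) ⟩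
    a * ((a + d) * d)               ∎
    where
    open ≡-Reasoning
    b≡a+d : b ≡ a + d
    b≡a+d = trans (cong (_∸ a) (trans n≡ (+-assoc a a d))) (m+n∸m≡n a (a + d))

-- The arithmetic of the split

errorTerm-bound : ∀ d t → t ≤ 6 * d + 5 → 14 ≤ d →
                  36 * (d * d) * (t * t) + 32 * (t * t * t) ≤ 2592 * (d * d * d * d)
errorTerm-bound d t t≤6d+5 14≤d = begin
  36 * (d * d) * (t * t) + 32 * (t * t * t) ≡⟨ factor d t ⟩
  t * t * (36 * (d * d) + 32 * t)           ≤⟨ *-monoʳ-≤ (t * t) (+-monoʳ-≤ (36 * (d * d)) 32t≤16d²) ⟩
  t * t * (36 * (d * d) + 16 * (d * d))     ≤⟨ *-monoˡ-≤ _ (*-mono-≤ t≤7d t≤7d) ⟩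
  7 * d * (7 * d) * (36 * (d * d) + 16 * (d * d)) ≡⟨ collect d ⟩
  2548 * (d * d * d * d)                    ≤⟨ *-monoˡ-≤ (d * d * d * d) (m≤m+n 2548 44) ⟩
  2592 * (d * d * d * d)                    ∎
  where
  open ≤-Reasoning
  factor : ∀ d t → 36 * (d * d) * (t * t) + 32 * (t * t * t) ≡ t * t * (36 * (d * d) + 32 * t)
  factor = solve-∀
  collect : ∀ d → 7 * d * (7 * d) * (36 * (d * d) + 16 * (d * d)) ≡ 2548 * (d * d * d * d)
  collect = solve-∀
  sixPlusOne : ∀ d → 6 * d + d ≡ 7 * d
  sixPlusOne = solve-∀
  regroup : ∀ d → 32 * (7 * d) ≡ 16 * (14 * d)
  regroup = solve-∀
  t≤7d : t ≤ 7 * d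
  t≤7d = ≤-trans t≤6d+5 (≤-trans (+-monoʳ-≤ (6 * d) (≤-trans (m≤m+n 5 9) 14≤d)) (≤-reflexive (sixPlusOne d)))
  32t≤16d² : 32 * t ≤ 16 * (d * d)
  32t≤16d² = ≤-trans (*-monoʳ-≤ 32 t≤7d) (≤-trans (≤-reflexive (regroup d)) (*-monoʳ-≤ 16 (*-monoˡ-≤ d 14≤d)))

-- With n² = 3d² + 2t, the excess of 4n⁶ over 108(2M)² is 36d²t² + 32t³, which is O(Mn) when t = O(d).
sixthPower-bound : ∀ n d t M → n * n ≡ 3 * (d * d) + 2 * t → 2 * M ≡ (d * d + t) * d →
                   t ≤ 6 * d + 5 → 14 ≤ d → d ≤ n → n ^ 6 ≤ 108 * (M + 6 * n) ^ 2
sixthPower-bound n d t M n²≡ 2M≡ t≤6d+5 14≤d d≤n = *-cancelˡ-≤ 4 (begin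
  4 * n ^ 6                                        ≡⟨ sixth n ⟩
  4 * (n * n * (n * n) * (n * n))                  ≡⟨ cong (λ s → 4 * (s * s * s)) n²≡ ⟩
  4 * (s * s * s)                                  ≡⟨ expand d t ⟩
  108 * (X * X) + E                                ≡⟨ cong (λ x → 108 * (x * x) + E) 2M≡ ⟨
  108 * (2 * M * (2 * M)) + E                      ≤⟨ +-monoʳ-≤ (108 * (2 * M * (2 * M))) (errorTerm-bound d t t≤6d+5 14≤d) ⟩
  108 * (2 * M * (2 * M)) + 2592 * (d * d * d * d) ≤⟨ +-monoʳ-≤ (108 * (2 * M * (2 * M))) (*-monoʳ-≤ 2592 d⁴≤2Mn) ⟩
  108 * (2 * M * (2 * M)) + 2592 * (2 * M * n)     ≤⟨ m≤m+n _ (15552 * (n * n)) ⟩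
  108 * (2 * M * (2 * M)) + 2592 * (2 * M * n) + 15552 * (n * n) ≡⟨ square M n ⟩
  4 * (108 * (M + 6 * n) ^ 2)                      ∎)
  where
  open ≤-Reasoning
  s X E : ℕ
  s = 3 * (d * d) + 2 * t
  X = (d * d + t) * d
  E = 36 * (d * d) * (t * t) + 32 * (t * t * t)
  sixth : ∀ n → 4 * (n * (n * (n * (n * (n * (n * 1)))))) ≡ 4 * (n * n * (n * n) * (n * n))
  sixth = solve-∀
  expand : ∀ d t → 4 * ((3 * (d * d) + 2 * t) * (3 * (d * d) + 2 * t) * (3 * (d * d) + 2 * t))
           ≡ 108 * ((d * d + t) * d * ((d * d + t) * d)) + (36 * (d * d) * (t * t) + 32 * (t * t * t))
  expand = solve-∀
  square : ∀ M n → 108 * (2 * M * (2 * M)) + 2592 * (2 * M * n) + 15552 * (n * n) ≡ 4 * (108 * ((M + 6 * n) * ((M + 6 * n) * 1)))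
  square = solve-∀
  d⁴≤2Mn : d * d * d * d ≤ 2 * M * n
  d⁴≤2Mn = *-mono-≤ (≤-trans (*-monoˡ-≤ d (m≤m+n (d * d) t)) (≤-reflexive (≡.sym 2M≡))) d≤n

split-bound : ∀ {n} a d → n ≡ a + a + d → 3 * (d * d) ≤ n * n → n * n < 3 * ((2 + d) * (2 + d)) → 30 ≤ n →
              n ^ 6 ≤ 108 * (a * ((a + d) * d) + 6 * n) ^ 2
split-bound {n} a d refl lower upper 30≤n =
  sixthPower-bound n d t (a * ((a + d) * d)) n²≡ 2M≡ t≤6d+5 14≤d (m≤n+m d (a + a))
  where
  s : ℕ
  s = a * (a + d)
  n²-split : n * n ≡ 2 * (2 * s) + d * d
  n²-split = square a d
    where square : ∀ a d → (a + a + d) * (a + a + d) ≡ 2 * (2 * (a * (a + d))) + d * d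
          square = solve-∀
  d²≤2s : d * d ≤ 2 * s
  d²≤2s = *-cancelˡ-≤ 2 (+-cancelʳ-≤ (d * d) (2 * (d * d)) (2 * (2 * s))
            (≤-trans (≤-reflexive (threeTimes (d * d))) (≤-trans lower (≤-reflexive n²-split))))
    where threeTimes : ∀ x → 2 * x + x ≡ 3 * x
          threeTimes = solve-∀
  t : ℕ
  t = 2 * s ∸ d * d
  2s≡ : 2 * s ≡ d * d + t
  2s≡ = ≡.sym (m+[n∸m]≡n d²≤2s)
  n²≡ : n * n ≡ 3 * (d * d) + 2 * t
  n²≡ = trans n²-split (trans (cong (λ x → 2 * x + d * d) 2s≡) (regroup (d * d) t))
    where regroup : ∀ x t → 2 * (x + t) + x ≡ 3 * x + 2 * t
          regroup = solve-∀
  2M≡ : 2 * (a * ((a + d) * d)) ≡ (d * d + t) * d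
  2M≡ = trans (reassoc a d) (cong (_* d) 2s≡)
    where reassoc : ∀ a d → 2 * (a * ((a + d) * d)) ≡ 2 * (a * (a + d)) * d
          reassoc = solve-∀
  t≤6d+5 : t ≤ 6 * d + 5
  t≤6d+5 = ≤-pred (*-cancelˡ-< 2 t (1 + (6 * d + 5)) (+-cancelˡ-< (3 * (d * d)) (2 * t) _
             (subst₂ _<_ n²≡ (expand d) upper)))
    where expand : ∀ d → 3 * ((2 + d) * (2 + d)) ≡ 3 * (d * d) + 2 * (1 + (6 * d + 5))
          expand = solve-∀
  14≤d : 14 ≤ d
  14≤d = ≮⇒≥ λ d<14 → <⇒≱ (<-≤-trans upper (*-monoʳ-≤ 3 (*-mono-≤ (s≤s d<14) (s≤s d<14))))
                           (≤-trans (m≤m+n 675 225) (*-mono-≤ 30≤n 30≤n))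

lastFailure : ∀ {p} {P : ℕ → Set p} → Decidable P → ∀ {k} → ¬ P 0 → P k → ∃ λ j → j < k × ¬ P j × P (suc j)
lastFailure P? {zero}  ¬P0 P0  = contradiction P0 ¬P0
lastFailure P? {suc k} ¬P0 Pk+1 with P? k
... | no  ¬Pk = k , n<1+n k , ¬Pk , Pk+1
... | yes Pk  with lastFailure P? ¬P0 Pk
...   | j , j<k , ¬Pj , Pj+1 = j , m<n⇒m<1+n j<k , ¬Pj , Pj+1

m*2≡m+m : ∀ m → m * 2 ≡ m + m
m*2≡m+m = solve-∀

-- For d = n − 2a, 3d² ≤ n² says d ≤ n/√3, the point where (n² − d²)d is maximal.
Balanced : ℕ → ℕ → Set
Balanced n a = 3 * ((n ∸ (a + a)) * (n ∸ (a + a))) ≤ n * n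

balanced? : ∀ n → Decidable (Balanced n)
balanced? n a = _ ≤? _

¬balanced-0 : ∀ {n} → 0 < n * n → ¬ Balanced n 0
¬balanced-0 {n} 0<n² = <⇒≱ (m<m+n (n * n) (≤-trans 0<n² (m≤m+n (n * n) _)))

balanced-half : ∀ n → 3 ≤ n * n → Balanced n (n / 2)
balanced-half n 3≤n² = ≤-trans (*-monoʳ-≤ 3 (*-mono-≤ r≤1 r≤1)) 3≤n²
  where
  h = n / 2
  r≡n%2 : n ∸ (h + h) ≡ n % 2
  r≡n%2 = trans (cong (_∸ (h + h)) (trans (m≡m%n+[m/n]*n n 2) (cong (n % 2 +_) (m*2≡m+m h))))
                (m+n∸n≡m (n % 2) (h + h))
  r≤1 : n ∸ (h + h) ≤ 1
  r≤1 = subst (_≤ 1) (≡.sym r≡n%2) (≤-pred (m%n<n n 2))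

BalancedSplit : ℕ → Set
BalancedSplit n = ∃ λ a → ∃ λ d → 0 < a × n ≡ a + a + d × 3 * (d * d) ≤ n * n × n * n < 3 * ((2 + d) * (2 + d))

balancedSplit : ∀ n → 30 ≤ n → BalancedSplit n
balancedSplit n 30≤n = fromCrossing (lastFailure (balanced? n)
                                                 (¬balanced-0 {n} (≤-trans (s≤s z≤n) 900≤n²))
                                                 (balanced-half n (≤-trans (m≤m+n 3 897) 900≤n²)))
  where
  900≤n² : 900 ≤ n * n
  900≤n² = *-mono-≤ 30≤n 30≤n
  fromCrossing : (∃ λ j → j < n / 2 × ¬ Balanced n j × Balanced n (suc j)) → BalancedSplit n
  fromCrossing (j , j<h , ¬Bj , Bj+1) = a , d , z<s , n≡ , Bj+1 , subst (λ r → n * n < 3 * (r * r)) r≡ (≰⇒> ¬Bj)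
    where
    a d : ℕ
    a = suc j
    d = n ∸ (a + a)
    a+a≤n : a + a ≤ n
    a+a≤n = ≤-trans (+-mono-≤ j<h j<h) (≤-trans (≤-reflexive (≡.sym (m*2≡m+m (n / 2)))) (m/n*n≤m n 2))
    n≡ : n ≡ a + a + d
    n≡ = ≡.sym (m+[n∸m]≡n a+a≤n)
    shift : ∀ j d → suc j + suc j + d ≡ j + j + (2 + d)
    shift = solve-∀
    r≡ : n ∸ (j + j) ≡ 2 + d
    r≡ = trans (cong (_∸ (j + j)) (trans n≡ (shift j d))) (m+n∸m≡n (j + j) (2 + d))

mainTheorem2 : ∃ λ N → ∀ n → N ≤ n →
    Σ (Graph n) λ G → Connected G × Bipartite G × (n ^ 6 ≤ 108 * (Mostar G + 6 * n) ^ 2)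
mainTheorem2 = 30 , λ n 30≤n → fromSplit (balancedSplit n 30≤n) 30≤n
  where
  -- Matching on balancedSplit n 30≤n in place would make the type checker unfold its proof.
  fromSplit : ∀ {n} → BalancedSplit n → 30 ≤ n →
              Σ (Graph n) λ G → Connected G × Bipartite G × (n ^ 6 ≤ 108 * (Mostar G + 6 * n) ^ 2)
  fromSplit {n} (a , d , 0<a , n≡ , lower , upper) 30≤n =
    K , connected , bipartite ,
    subst (λ m → n ^ 6 ≤ 108 * (m + 6 * n) ^ 2) (≡.sym (mostar-K-split n≡)) (split-bound a d n≡ lower upper 30≤n)
    where
    a<n : a < n
    a<n = <-≤-trans (m<m+n a 0<a) (≤-trans (m≤m+n (a + a) d) (≤-reflexive (≡.sym n≡)))
    open CompleteBipartite a 0<a a<n
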